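{- Let $G=(\Gamma,s)$ be a graph with vertex set $V$ and non-sink vertex set $\tilde V=V\setminus\{s\}$. Then the map $c\mapsto \mathbf{deg}-c$ (where $\mathbf{deg}:\tilde V\to\mathbb N$, $v\mapsto\deg(v)$) is a bijection from the set $\mathrm{SR}(G)$ of strongly recurrent configurations on $G$ to the set $\mathrm{PPF}(G)$ of prime $G$-parking functions.
   Context: A graph $G=(\Gamma,s)$ is a finite, undirected, connected multigraph (multiple edges allowed, no loops) with vertex set $V$ and a distinguished vertex $s$, the sink; $\tilde V:=V\setminus\{s\}$. For $v,w\in V$, $\mathrm{mult}(vw)$ is the number of edges between $v$ and $w$; for $A\subseteq V$, $\deg^A(v):=\sum_{w\in A}\mathrm{mult}(vw)$, and $\deg(v):=\deg^V(v)$. $\mathbb N=\{1,2,\dots\}$ and $\mathbb 1_v$ is the indicator function of $v$. For $A\subseteq\tilde V$, $G^A$ denotes the induced subgraph of $G$ on $A\cup\{s\}$, with sink $s$ (it need not be connected). Parking functions: for a graph $H$ with sink $s$, vertex set $V_H$ and non-sink vertex set $\tilde V_H$, an $H$-parking function is a function $p:\tilde V_H\to\mathbb N$ such that for every non-empty $S\subseteq\tilde V_H$ there exists $v\in S$ with $p(v)\le\deg_H^{V_H\setminus S}(v)$. $\mathrm{PF}(H)$ denotes the set of $H$-parking functions. For $p\in\mathrm{PF}(G)$ and an ordered set partition $(A,B)$ of $\tilde V$ with $A,B\neq\emptyset$, define $p^A:A\to\mathbb N$ by $p^A(v)=p(v)$ and $p^B:B\to\mathbb Z$ by $p^B(v)=p(v)-\deg^A(v)$.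 $p$ is decomposable with respect to $(A,B)$ if $p^A\in\mathrm{PF}(G^A)$ and $p^B\in\mathrm{PF}(G^B)$. $p$ is prime if there is no such ordered partition with respect to which it is decomposable; $\mathrm{PPF}(G)$ is the set of prime $G$-parking functions. Sandpiles: a configuration is a function $c:\tilde V\to\mathbb Z$; it is stable if $c(v)<\deg(v)$ for all $v\in\tilde V$. A stable configuration $c$ is recurrent if it is a recurrent state of the Abelian sandpile Markov chain on stable configurations (add a grain at a random non-sink vertex, each having positive probability, then stabilise by repeatedly toppling unstable vertices, a toppling at $v$ replacing $c$ by $c-\deg(v)\mathbb 1_v+\sum_{w\in\tilde V}\mathrm{mult}(vw)\mathbb 1_w$); equivalently (Dhar's burning criterion), $c$ is stable and there is an ordering $v_1,\dots,v_{|\tilde V|}$ of $\tilde V$ with $c(v_i)\ge\deg^{V\setminus\{s,v_1,\dots,v_{i-1}\}}(v_i)$ for all $i$. $\mathrm{Rec}(G)$ is the set of recurrent configurations. For $c\in\mathrm{Rec}(G)$ let $V_M(c):=\{v\in\tilde V:\mathrm{mult}(vs)\ge1,\ c(v)\ge\deg(v)-\mathrm{mult}(vs)\}$ and for $v\in V_M(c)$ let $c^{v- }:=c-\sum_{w\in\tilde V\setminus\{v\}}\mathrm{mult}(ws)\mathbb 1_w$. A recurrent $c$ is strongly recurrent if $c^{v- }\in\mathrm{Rec}(G)$ for all $v\in V_M(c)$; $\mathrm{SR}(G)$ is the set of strongly recurrent configurations. -}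

module Defs where

open import Data.Nat using (ℕ; zero; suc; _+_) renaming (_≤_ to _≤ℕ_)
open import Data.Integer using (ℤ; +_; _-_; _≤_)
open import Data.Fin using (Fin; zero; suc; _<_)
open import Data.Bool using (Bool; true; false; not; if_then_else_; _∧_)
open import Data.Product using (Σ; ∃; _×_; _,_)
open import Relation.Binary.PropositionalEquality using (_≡_; _≢_)
open import Relation.Nullary using (¬_)
open import Function.Bundles using (_↔_; Inverse)

sumFin : {n : ℕ} → (Fin n → ℕ) → ℕ
sumFin {zero}  f = 0
sumFin {suc n} f = f zero + sumFin (λ i → f (suc i))

-- A graph with sink: vertex set V = Fin (suc n), sink s = zero,
-- non-sink vertices Ṽ = { suc v | v : Fin n }.  mult u w = number of edges.
data Reach {m : ℕ} (mult : Fin m → Fin m → ℕ) : Fin m → Fin m → Set where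
  here : ∀ {u} → Reach mult u u
  step : ∀ {u v w} → 1 ≤ℕ mult u v → Reach mult v w → Reach mult u w

record Graph (n : ℕ) : Set where
  field
    mult      : Fin (suc n) → Fin (suc n) → ℕ
    symmetric : ∀ u w → mult u w ≡ mult w u
    loopless  : ∀ u → mult u u ≡ 0
    connected : ∀ u w → Reach mult u w

module _ {n : ℕ} (G : Graph n) where
  open Graph G

  sink : Fin (suc n)
  sink = zero

  m : Fin n → Fin n → ℕ
  m v w = mult (suc v) (suc w)

  ms : Fin n → ℕ
  ms v = mult (suc v) sink

  degG : Fin n → ℤ
  degG v = + sumFin (λ w → mult (suc v) w)

  degIn : (Fin n → Bool) → Fin n → ℤ
  degIn A v = + sumFin (λ w → if A w then m v w else 0)

  _⊆_ : (Fin n → Bool) → (Fin n → Bool) → Set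
  S ⊆ A = ∀ v → S v ≡ true → A v ≡ true

  -- p is a G^A-parking function (only the values of p on A matter).
  -- G^A has vertex set A ∪ {s}; for S ⊆ A, V_{G^A} \ S = {s} ∪ (A \ S).
  IsPFOn : (Fin n → Bool) → (Fin n → ℤ) → Set
  IsPFOn A p =
    (∀ v → A v ≡ true → + 1 ≤ p v) ×
    (∀ (S : Fin n → Bool) → S ⊆ A → (∃ λ v → S v ≡ true) →
       ∃ λ v → S v ≡ true × p v ≤ + ms v Data.Integer.+ degIn (λ w → A w ∧ not (S w)) v)

  allV : Fin n → Bool
  allV _ = true

  IsPF : (Fin n → ℤ) → Set
  IsPF p = IsPFOn allV p

  DecomposableWrt : (Fin n → ℤ) → (Fin n → Bool) → Set
  DecomposableWrt p A =
    IsPFOn A p × IsPFOn (λ v → not (A v)) (λ v → p v - degIn A v)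

  IsPrimePF : (Fin n → ℤ) → Set
  IsPrimePF p = IsPF p ×
    (∀ (A : Fin n → Bool) → (∃ λ v → A v ≡ true) → (∃ λ v → A v ≡ false) →
       ¬ DecomposableWrt p A)

  IsStable : (Fin n → ℤ) → Set
  IsStable c = ∀ v → c v Data.Integer.< degG v

  -- Recurrent (Dhar's burning criterion): ordering σ of Ṽ with
  -- c(σ i) ≥ deg^{V \ {s, σ 0, …, σ (i-1)}}(σ i).
  IsRecurrent : (Fin n → ℤ) → Set
  IsRecurrent c = IsStable c ×
    Σ (Fin n ↔ Fin n) λ σ →
      ∀ i → degIn (λ w → notBefore σ i w) (Inverse.to σ i) ≤ c (Inverse.to σ i)
    where
    notBefore : (Fin n ↔ Fin n) → Fin n → Fin n → Bool
    notBefore σ i w with Data.Fin._<?_ (Inverse.from σ w) i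
    ... | Relation.Nullary.yes _ = false
    ... | Relation.Nullary.no _ = true

  InVM : (Fin n → ℤ) → Fin n → Set
  InVM c v = (1 ≤ℕ ms v) × (degG v - + ms v ≤ c v)

  minusAt : (Fin n → ℤ) → Fin n → Fin n → ℤ
  minusAt c v w with Data.Fin._≟_ w v
  ... | Relation.Nullary.yes _ = c w
  ... | Relation.Nullary.no _ = c w - + ms w

  IsStronglyRecurrent : (Fin n → ℤ) → Set
  IsStronglyRecurrent c = IsRecurrent c × (∀ v → InVM c v → IsRecurrent (minusAt c v))

  degMinus : (Fin n → ℤ) → Fin n → ℤ
  degMinus c v = degG v - c v

-- Through p = deg − c, Dhar's burning test and the parking condition are the same
-- inequality: u ∈ S burns (deg^S(u) ≤ c(u)) iff it parks (p(u) ≤ mult(us) + deg^{Ṽ∖S}(u)).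
-- Hence c is recurrent iff deg − c is a G-parking function, and c ↦ deg − c is an
-- involution. For v ∈ V_M(c), deg − c^{v−} is p raised by mult(ws) at every w ≠ v.
-- If p decomposes along (A, B), the parking condition of p^A on A itself yields v ∈ A
-- with p(v) ≤ mult(vs), i.e. v ∈ V_M(c), and the raised function cannot park on B since
-- p^B is positive. Conversely, for p prime and v ∈ V_M(c), the raised function parks on
-- every S: at v if v ∈ S, and otherwise at some w ∈ S with p(w) ≤ deg^{Ṽ∖S}(w), for if
-- there were none, burning induced subgraphs outwards from v would stop at a
-- decomposition of p avoiding S.

module Submission where

open import Defs hiding (_⊆_)
open import Data.Nat using (ℕ; zero; suc; z≤n; s≤s; s≤s⁻¹; s<s⁻¹)
  renaming (_+_ to _+ℕ_; _≤_ to _≤ℕ_; _<_ to _<ℕ_)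
import Data.Nat.Properties as ℕ
open import Data.Integer using (ℤ; +_; 0ℤ; 1ℤ; _+_; _-_; _≤_; _<_; +≤+; _≤?_)
import Data.Integer.Properties as ℤ
open import Data.Integer.Tactic.RingSolver using (solve-∀)
open import Data.Fin using (Fin; zero; suc; toℕ; fromℕ<; punchOut; _≟_; _<?_)
  renaming (_<_ to _<ᶠ_)
open import Data.Fin.Properties using (any?; toℕ-fromℕ<; punchOut-injective; injective⇒≤)
open import Data.Bool using (Bool; true; false; not; _∧_; _∨_; if_then_else_)
import Data.Bool.Properties as Bool
open import Data.Product using (Σ; ∃; _×_; _,_; proj₁; proj₂)
open import Data.Sum using (_⊎_; inj₁; inj₂)
open import Data.Empty using (⊥-elim)
open import Function using (_∘_)
open import Function.Bundles using (_↔_; _⇔_; Inverse; Equivalence; mk↔ₛ′; mk⇔)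
open import Relation.Nullary using (¬_; yes; no; does)
open import Relation.Nullary.Decidable using (_×-dec_)
open import Relation.Unary using (Decidable)
open import Relation.Binary.PropositionalEquality
open import Algebra.Properties.CommutativeSemigroup ℕ.+-commutativeSemigroup
  using (interchange)

private variable k : ℕ

∧-trueˡ : ∀ {x y} → x ∧ y ≡ true → x ≡ true
∧-trueˡ {true} _ = refl

∧-trueʳ : ∀ {x y} → x ∧ y ≡ true → y ≡ true
∧-trueʳ {true} e = e

not-true : ∀ {x} → not x ≡ true → x ≡ false
not-true {false} _ = refl

sumFin-cong : {f g : Fin k → ℕ} → f ≗ g → sumFin f ≡ sumFin g
sumFin-cong {zero}  f≗g = refl
sumFin-cong {suc k} f≗g = cong₂ _+ℕ_ (f≗g zero) (sumFin-cong (f≗g ∘ suc))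

sumFin-mono : {f g : Fin k → ℕ} → (∀ i → f i ≤ℕ g i) → sumFin f ≤ℕ sumFin g
sumFin-mono {zero}  f≤g = z≤n
sumFin-mono {suc k} f≤g = ℕ.+-mono-≤ (f≤g zero) (sumFin-mono (f≤g ∘ suc))

sumFin-+ : (f g : Fin k → ℕ) → sumFin (λ i → f i +ℕ g i) ≡ sumFin f +ℕ sumFin g
sumFin-+ {zero}  f g = refl
sumFin-+ {suc k} f g =
  trans (cong (f zero +ℕ g zero +ℕ_) (sumFin-+ (f ∘ suc) (g ∘ suc)))
        (interchange (f zero) (g zero) (sumFin (f ∘ suc)) (sumFin (g ∘ suc)))

sumFin-zero : ∀ k → sumFin {k} (λ _ → 0) ≡ 0
sumFin-zero zero    = refl
sumFin-zero (suc k) = sumFin-zero k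

-- The `_⊆_` of Defs takes a graph argument; this is the same relation on any Fin k.
infix 4 _⊆_
_⊆_ : (Fin k → Bool) → (Fin k → Bool) → Set
S ⊆ T = ∀ w → S w ≡ true → T w ≡ true

NonEmpty : (Fin k → Bool) → Set
NonEmpty S = ∃ λ w → S w ≡ true

insert : Fin k → (Fin k → Bool) → Fin k → Bool
insert u A w = does (w ≟ u) ∨ A w

remove : Fin k → (Fin k → Bool) → Fin k → Bool
remove u S w = S w ∧ not (does (w ≟ u))

∈-remove : ∀ {u w} (S : Fin k → Bool) → w ≢ u → S w ≡ true → remove u S w ≡ true
∈-remove {u = u} {w} S w≢u Sw with w ≟ u
... | yes w≡u = ⊥-elim (w≢u w≡u)
... | no _ rewrite Sw = refl

bit : Bool → ℕ
bit b = if b then 1 else 0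

count : (Fin k → Bool) → ℕ
count S = sumFin (bit ∘ S)

count-all : ∀ k → count {k} (λ _ → true) ≡ k
count-all zero    = refl
count-all (suc k) = cong suc (count-all k)

count-single : (u : Fin k) → count (λ w → does (w ≟ u)) ≡ 1
count-single {suc k} zero    = cong suc (sumFin-zero k)
count-single {suc k} (suc u) = count-single u

count-peel : (u : Fin k) (X Y : Fin k → Bool) →
             (∀ w → bit (X w) ≡ bit (Y w) +ℕ bit (does (w ≟ u))) →
             count X ≡ suc (count Y)
count-peel u X Y split = begin
  count X                                           ≡⟨ sumFin-cong split ⟩
  sumFin (λ w → bit (Y w) +ℕ bit (does (w ≟ u)))   ≡⟨ sumFin-+ (bit ∘ Y) (λ w → bit (does (w ≟ u))) ⟩
  count Y +ℕ count (λ w → does (w ≟ u))             ≡⟨ cong (count Y +ℕ_) (count-single u) ⟩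
  count Y +ℕ 1                                      ≡⟨ ℕ.+-comm (count Y) 1 ⟩
  suc (count Y)                                     ∎
  where open ≡-Reasoning

count-remove : ∀ {u} {S : Fin k → Bool} → S u ≡ true → count S ≡ suc (count (remove u S))
count-remove {u = u} {S} Su = count-peel u S (remove u S) split
  where
  split : ∀ w → bit (S w) ≡ bit (remove u S w) +ℕ bit (does (w ≟ u))
  split w with w ≟ u
  ... | yes refl rewrite Su = refl
  ... | no _ with S w
  ...   | true  = refl
  ...   | false = refl

count-insert : ∀ {u} {A : Fin k → Bool} → A u ≡ false →
               count (not ∘ A) ≡ suc (count (not ∘ insert u A))
count-insert {u = u} {A} Au = count-peel u (not ∘ A) (not ∘ insert u A) split
  where
  split : ∀ w → bit (not (A w)) ≡ bit (not (insert u A w)) +ℕ bit (does (w ≟ u))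
  split w with w ≟ u
  ... | yes refl rewrite Au = refl
  ... | no _     = sym (ℕ.+-identityʳ _)

least : {P : Fin k → Set} → Decidable P → ∃ P → ∃ λ i → P i × (∀ j → j <ᶠ i → ¬ P j)
least {suc k} {P} P? (w , Pw) with P? zero
... | yes P0 = zero , P0 , λ _ ()
... | no ¬P0 with w
...   | zero   = ⊥-elim (¬P0 Pw)
...   | suc w′ with least (P? ∘ suc) (w′ , Pw)
...     | i , Pi , below = suc i , Pi , earlier
  where
  earlier : ∀ j → j <ᶠ suc i → ¬ P j
  earlier zero    _   = ¬P0
  earlier (suc j) j<i = below j (s<s⁻¹ j<i)

injective⇒surjective : (f : Fin k → Fin k) → (∀ {x y} → f x ≡ f y → x ≡ y) →
                       ∀ j → ∃ λ i → f i ≡ j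
injective⇒surjective f f-inj j with any? (λ i → f i ≟ j)
... | yes hit = hit
injective⇒surjective {suc k} f f-inj j | no miss =
  ⊥-elim (ℕ.1+n≰n (injective⇒≤ {f = squeeze} (f-inj ∘ punchOut-injective (avoids _) (avoids _))))
  where
  avoids : ∀ i → j ≢ f i
  avoids i j≡fi = miss (i , sym j≡fi)
  squeeze : Fin (suc k) → Fin k
  squeeze i = punchOut (avoids i)

saturate : (Inv Done : (Fin k → Bool) → Set) →
           (∀ {A} → Inv A → Done A ⊎ ∃ λ w → A w ≡ false × Inv (insert w A)) →
           ∀ {A} → Inv A → ∃ λ A → Inv A × Done A
saturate Inv Done grow {A} inv = go _ A refl inv
  where
  go : ∀ m A → count (not ∘ A) ≡ m → Inv A → ∃ λ A → Inv A × Done A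
  go m A ∣∁A∣ inv with grow inv
  ... | inj₁ done = A , inv , done
  go zero    A ∣∁A∣ inv | inj₂ (w , Aw , _) =
    ⊥-elim (ℕ.0≢1+n (trans (sym ∣∁A∣) (count-insert {A = A} Aw)))
  go (suc m) A ∣∁A∣ inv | inj₂ (w , Aw , inv′) =
    go m (insert w A) (ℕ.suc-injective (trans (sym (count-insert {A = A} Aw)) ∣∁A∣)) inv′

≤-bySlack : ∀ {a b x y : ℤ} → b - a ≡ y - x → a ≤ b → x ≤ y
≤-bySlack same a≤b = ℤ.0≤i-j⇒j≤i (subst (0ℤ ≤_) same (ℤ.i≤j⇒0≤j-i a≤b))

i<j⇔1≤j-i : ∀ {i j : ℤ} → i < j ⇔ 1ℤ ≤ j - i
i<j⇔1≤j-i {i} {j} = mk⇔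
  (λ i<j → ≤-bySlack (slack i j) (ℤ.i<j⇒suc[i]≤j i<j))
  (λ 1≤j-i → ℤ.suc[i]≤j⇒i<j (≤-bySlack (sym (slack i j)) 1≤j-i))
  where
  slack : ∀ i j → j - (1ℤ + i) ≡ (j - i) - 1ℤ
  slack = solve-∀

1≰0 : ¬ (1ℤ ≤ 0ℤ)
1≰0 (+≤+ ())

-- Elimination orders

remaining : Fin k ↔ Fin k → Fin k → Fin k → Bool
remaining σ i w with Inverse.from σ w <? i
... | yes _ = false
... | no _  = true

remaining-true : ∀ (σ : Fin k ↔ Fin k) {i w} → remaining σ i w ≡ true → ¬ (Inverse.from σ w <ᶠ i)
remaining-true σ {i} {w} with Inverse.from σ w <? i
... | yes _ = λ ()
... | no ≮  = λ _ → ≮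

module _ (P : (Fin k → Bool) → Fin k → Set) where

  Antitone : Set
  Antitone = ∀ {S S′ u} → S ⊆ S′ → P S′ u → P S u

  Choice : Set
  Choice = ∀ S → NonEmpty S → ∃ λ u → S u ≡ true × P S u

  EliminationOrder : Fin k ↔ Fin k → Set
  EliminationOrder σ = ∀ i → P (remaining σ i) (Inverse.to σ i)

  eliminationOrder⇒choice : Antitone → ∀ {σ} → EliminationOrder σ → Choice
  eliminationOrder⇒choice P-antitone {σ} order S (w , Sw)
    with least (λ i → S (Inverse.to σ i) Bool.≟ true)
               (Inverse.from σ w , trans (cong S (Inverse.strictlyInverseˡ σ w)) Sw)
  ... | i , Sσi , first = Inverse.to σ i , Sσi , P-antitone S⊆remaining (order i)
    where
    S⊆remaining : S ⊆ remaining σ i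
    S⊆remaining x Sx with Inverse.from σ x <? i
    ... | yes before = ⊥-elim (first _ before (trans (cong S (Inverse.strictlyInverseˡ σ x)) Sx))
    ... | no _       = refl

  module _ (P-antitone : Antitone) (choice : Choice) where

    -- rank w is the step at which the greedy elimination of S removes w.
    record Ranking (S : Fin k → Bool) : Set where
      field
        rank     : Fin k → ℕ
        rank<    : ∀ {w} → S w ≡ true → rank w <ℕ count S
        rank-inj : ∀ {w w′} → S w ≡ true → S w′ ≡ true → rank w ≡ rank w′ → w ≡ w′
        rank-P   : ∀ {u} → S u ≡ true →
                   ∀ {X} → (∀ w → X w ≡ true → S w ≡ true × rank u ≤ℕ rank w) → P X u

    ranking : ∀ m S → count S ≡ m → Ranking S
    ranking m S ∣S∣ with any? (λ w → S w Bool.≟ true)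
    ... | no empty = record
      { rank = λ _ → 0
      ; rank< = λ Sw → ⊥-elim (empty (_ , Sw))
      ; rank-inj = λ Sw _ _ → ⊥-elim (empty (_ , Sw))
      ; rank-P = λ Su _ → ⊥-elim (empty (_ , Su))
      }
    ranking zero S ∣S∣ | yes (w , Sw) = ⊥-elim (ℕ.0≢1+n (trans (sym ∣S∣) (count-remove {S = S} Sw)))
    ranking (suc m) S ∣S∣ | yes nonempty with choice S nonempty
    ... | u , Su , Pu = record { rank = rank ; rank< = rank< ; rank-inj = rank-inj ; rank-P = rank-P }
      where
      S′ : Fin k → Bool
      S′ = remove u S
      ∣S′∣ : count S′ ≡ m
      ∣S′∣ = ℕ.suc-injective (trans (sym (count-remove {S = S} Su)) ∣S∣)
      module R = Ranking (ranking m S′ ∣S′∣)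

      rank : Fin k → ℕ
      rank w = if does (w ≟ u) then 0 else suc (R.rank w)

      rank< : ∀ {w} → S w ≡ true → rank w <ℕ count S
      rank< {w} Sw = subst (rank w <ℕ_) (sym ∣S∣) rank<1+m
        where
        rank<1+m : rank w <ℕ suc m
        rank<1+m with w ≟ u
        ... | yes _   = s≤s z≤n
        ... | no w≢u = s≤s (subst (R.rank w <ℕ_) ∣S′∣ (R.rank< (∈-remove S w≢u Sw)))

      rank-inj : ∀ {w w′} → S w ≡ true → S w′ ≡ true → rank w ≡ rank w′ → w ≡ w′
      rank-inj {w} {w′} Sw Sw′ eq with w ≟ u | w′ ≟ u
      ... | yes refl | yes refl = refl
      ... | no w≢u   | no w′≢u  =
        R.rank-inj (∈-remove S w≢u Sw) (∈-remove S w′≢u Sw′) (ℕ.suc-injective eq)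

      rank-P : ∀ {u′} → S u′ ≡ true →
               ∀ {X} → (∀ w → X w ≡ true → S w ≡ true × rank u′ ≤ℕ rank w) → P X u′
      rank-P {u′} Su′ {X} X⊆ with u′ ≟ u
      ... | yes refl = P-antitone (λ w Xw → proj₁ (X⊆ w Xw)) Pu
      ... | no u′≢u  = R.rank-P (∈-remove S u′≢u Su′) X⊆S′
        where
        X⊆S′ : ∀ w → X w ≡ true → S′ w ≡ true × R.rank u′ ≤ℕ R.rank w
        X⊆S′ w Xw with w ≟ u | X⊆ w Xw
        ... | yes refl | _ , ()
        ... | no _     | Sw , r≤r = cong (_∧ true) Sw , s≤s⁻¹ r≤r

    choice⇒eliminationOrder : ∃ EliminationOrder
    choice⇒eliminationOrder = σ , order
      where
      open Ranking (ranking k (λ _ → true) (count-all k))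
      position : Fin k → Fin k
      position w = fromℕ< (subst (rank w <ℕ_) (count-all k) (rank< refl))
      toℕ-position : ∀ w → toℕ (position w) ≡ rank w
      toℕ-position w = toℕ-fromℕ< _
      position-inj : ∀ {w w′} → position w ≡ position w′ → w ≡ w′
      position-inj {w} {w′} eq =
        rank-inj refl refl (trans (sym (toℕ-position w)) (trans (cong toℕ eq) (toℕ-position w′)))
      vertexAt : Fin k → Fin k
      vertexAt i = proj₁ (injective⇒surjective position position-inj i)
      position-vertexAt : ∀ i → position (vertexAt i) ≡ i
      position-vertexAt i = proj₂ (injective⇒surjective position position-inj i)
      σ : Fin k ↔ Fin k
      σ = mk↔ₛ′ vertexAt position
                (λ w → position-inj (position-vertexAt (position w))) position-vertexAt
      order : EliminationOrder σ
      order i = rank-P refl λ w later → refl , subst₂ _≤ℕ_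
        (trans (cong toℕ (sym (position-vertexAt i))) (toℕ-position (vertexAt i)))
        (toℕ-position w) (ℕ.≮⇒≥ (remaining-true σ later))

module _ {n : ℕ} (G : Graph n) where

  edgesIn : (Fin n → Bool) → Fin n → Fin n → ℕ
  edgesIn X u w = if X w then m G u w else 0

  degIn-cong : ∀ {X Y : Fin n → Bool} u → X ≗ Y → degIn G X u ≡ degIn G Y u
  degIn-cong u X≗Y = cong +_ (sumFin-cong λ w → cong (λ b → if b then m G u w else 0) (X≗Y w))

  degIn-mono : ∀ {X Y : Fin n → Bool} u → X ⊆ Y → degIn G X u ≤ degIn G Y u
  degIn-mono {X} {Y} u X⊆Y = +≤+ (sumFin-mono edges)
    where
    edges : ∀ w → edgesIn X u w ≤ℕ edgesIn Y u w
    edges w with X w in Xw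
    ... | true  rewrite X⊆Y w Xw = ℕ.≤-refl
    ... | false = z≤n

  degIn-split : ∀ (X Y : Fin n → Bool) u →
                degIn G X u ≡ degIn G (λ w → X w ∧ Y w) u + degIn G (λ w → X w ∧ not (Y w)) u
  degIn-split X Y u =
    cong +_ (trans (sumFin-cong edges) (sumFin-+ (edgesIn X∩Y u) (edgesIn X∖Y u)))
    where
    X∩Y X∖Y : Fin n → Bool
    X∩Y w = X w ∧ Y w
    X∖Y w = X w ∧ not (Y w)
    edges : ∀ w → edgesIn X u w ≡ edgesIn X∩Y u w +ℕ edgesIn X∖Y u w
    edges w with X w | Y w
    ... | true  | true  = sym (ℕ.+-identityʳ _)
    ... | true  | false = refl
    ... | false | _     = refl

  degIn-∅ : ∀ u → degIn G (λ _ → false) u ≡ 0ℤ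
  degIn-∅ u = cong +_ (sumFin-zero n)

  degG-split : ∀ (S : Fin n → Bool) u →
               degG G u ≡ + ms G u + (degIn G S u + degIn G (λ w → not (S w)) u)
  degG-split S u = cong (_+_ (+ ms G u)) (degIn-split (λ _ → true) S u)

  -- Dhar's burning criterion

  Burns : (Fin n → ℤ) → (Fin n → Bool) → Fin n → Set
  Burns c S u = degIn G S u ≤ c u

  burns-antitone : ∀ {c} → Antitone (Burns c)
  burns-antitone {u = u} S⊆S′ = ℤ.≤-trans (degIn-mono u S⊆S′)

  -- `IsRecurrent` builds its sets of unburnt vertices in a `where` clause, so they
  -- have no name; `unburnt` recovers them from its type.
  unburnt : (c : Fin n → ℤ) → Fin n ↔ Fin n → Fin n → Fin n → Bool
  unburnt c = setsOf (IsRecurrent G c) refl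
    where
    setsOf : (T : Set) {X : Fin n ↔ Fin n → Fin n → Fin n → Bool} →
             T ≡ (IsStable G c × Σ (Fin n ↔ Fin n) λ σ →
                    ∀ i → degIn G (X σ i) (Inverse.to σ i) ≤ c (Inverse.to σ i)) →
             Fin n ↔ Fin n → Fin n → Fin n → Bool
    setsOf _ {X} _ = X

  unburnt≗remaining : ∀ c σ i → unburnt c σ i ≗ remaining σ i
  unburnt≗remaining c σ i w with Inverse.from σ w <? i
  ... | yes _ = refl
  ... | no _  = refl

  recurrent⇔stable×choice : ∀ c → IsRecurrent G c ⇔ (IsStable G c × Choice (Burns c))
  recurrent⇔stable×choice c = mk⇔
    (λ (stable , σ , burns) →
       stable , eliminationOrder⇒choice (Burns c) (burns-antitone {c}) λ i →
         subst (_≤ c (Inverse.to σ i)) (degIn-cong _ (unburnt≗remaining c σ i)) (burns i))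
    (λ (stable , choice) →
       let σ , order = choice⇒eliminationOrder (Burns c) (burns-antitone {c}) choice in
       stable , σ , λ i →
         subst (_≤ c (Inverse.to σ i)) (sym (degIn-cong _ (unburnt≗remaining c σ i))) (order i))

  parks⇔burns : ∀ c S u → degMinus G c u ≤ + ms G u + degIn G (λ w → not (S w)) u ⇔ Burns c S u
  parks⇔burns c S u rewrite degG-split S u = mk⇔
    (≤-bySlack (slack (+ ms G u) (degIn G S u) (degIn G (λ w → not (S w)) u) (c u)))
    (≤-bySlack (sym (slack (+ ms G u) (degIn G S u) (degIn G (λ w → not (S w)) u) (c u))))
    where
    slack : ∀ s a b c → (s + b) - ((s + (a + b)) - c) ≡ c - a
    slack = solve-∀

  parking⇔stable×choice : ∀ c → IsPF G (degMinus G c) ⇔ (IsStable G c × Choice (Burns c))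
  parking⇔stable×choice c = mk⇔
    (λ (positive , parks) →
       (λ v → Equivalence.from i<j⇔1≤j-i (positive v refl)) ,
       λ S nonempty → let u , Su , parked = parks S (λ _ _ → refl) nonempty in
                      u , Su , Equivalence.to (parks⇔burns c S u) parked)
    (λ (stable , choice) →
       (λ v _ → Equivalence.to i<j⇔1≤j-i (stable v)) ,
       λ S _ nonempty → let u , Su , burns = choice S nonempty in
                        u , Su , Equivalence.from (parks⇔burns c S u) burns)

  recurrent⇒parking : ∀ {c} → IsRecurrent G c → IsPF G (degMinus G c)
  recurrent⇒parking {c} =
    Equivalence.from (parking⇔stable×choice c) ∘ Equivalence.to (recurrent⇔stable×choice c)

  parking⇒recurrent : ∀ {c} → IsPF G (degMinus G c) → IsRecurrent G c
  parking⇒recurrent {c} =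
    Equivalence.from (recurrent⇔stable×choice c) ∘ Equivalence.to (parking⇔stable×choice c)

  -- Parking functions on induced subgraphs

  IsPFOn-resp : ∀ {A p q} → p ≗ q → IsPFOn G A p → IsPFOn G A q
  IsPFOn-resp p≗q (positive , parks) =
    (λ v Av → subst (1ℤ ≤_) (p≗q v) (positive v Av)) ,
    λ S S⊆A nonempty → let w , Sw , parked = parks S S⊆A nonempty in
                       w , Sw , subst (_≤ _) (p≗q w) parked

  IsPFOn-∅ : ∀ {p} → IsPFOn G (λ _ → false) p
  IsPFOn-∅ {p} = (λ _ ()) , parks
    where
    parks : ∀ S → S ⊆ (λ _ → false) → NonEmpty S →
            ∃ λ w → S w ≡ true × p w ≤ + ms G w + degIn G (λ z → false ∧ not (S z)) w
    parks S S⊆∅ (w , Sw) with () ← S⊆∅ w Sw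

  IsPFOn-insert : ∀ {A p w} → IsPFOn G A p → 1ℤ ≤ p w → p w ≤ + ms G w + degIn G A w →
                  IsPFOn G (insert w A) p
  IsPFOn-insert {A} {p} {w} (positive , parks) 1≤pw pw≤ = positive′ , parks′
    where
    positive′ : ∀ y → insert w A y ≡ true → 1ℤ ≤ p y
    positive′ y Ay with y ≟ w
    ... | yes refl = 1≤pw
    ... | no _     = positive y Ay
    parks′ : ∀ T → T ⊆ insert w A → NonEmpty T →
             ∃ λ x → T x ≡ true × p x ≤ + ms G x + degIn G (λ z → insert w A z ∧ not (T z)) x
    parks′ T T⊆ (t , Tt) with any? (λ y → (T y Bool.≟ true) ×-dec (A y Bool.≟ true))
    ... | yes (y , Ty , Ay) =
      let x , TAx , parked = parks (λ z → T z ∧ A z) (λ _ → ∧-trueʳ) (y , cong₂ _∧_ Ty Ay) in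
      x , ∧-trueˡ TAx , ℤ.≤-trans parked (ℤ.+-monoʳ-≤ (+ ms G x) (degIn-mono x shrink))
      where
      shrink : (λ z → A z ∧ not (T z ∧ A z)) ⊆ (λ z → insert w A z ∧ not (T z))
      shrink z e with A z | T z
      ... | true  | false = cong (_∧ true) (Bool.∨-zeroʳ _)
    ... | no T∩A≡∅ = w , subst (λ z → T z ≡ true) t≡w Tt ,
      ℤ.≤-trans pw≤ (ℤ.+-monoʳ-≤ (+ ms G w) (degIn-mono w A⊆))
      where
      t≡w : t ≡ w
      t≡w with t ≟ w | T⊆ t Tt
      ... | yes t≡w | _  = t≡w
      ... | no _    | At = ⊥-elim (T∩A≡∅ (t , Tt , At))
      A⊆ : A ⊆ (λ z → insert w A z ∧ not (T z))
      A⊆ z Az with T z in Tz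
      ... | true  = ⊥-elim (T∩A≡∅ (z , Tz , Az))
      ... | false = cong (_∧ true) (trans (cong (_ ∨_) Az) (Bool.∨-zeroʳ _))

  IsPFOn-root : ∀ {A p} → IsPFOn G A p → NonEmpty A → ∃ λ v → A v ≡ true × p v ≤ + ms G v
  IsPFOn-root {A} {p} (_ , parks) nonempty =
    let v , Av , parked = parks A (λ _ Aw → Aw) nonempty in
    v , Av , subst (p v ≤_) (noEdges v) parked
    where
    noEdges : ∀ v → + ms G v + degIn G (λ w → A w ∧ not (A w)) v ≡ + ms G v
    noEdges v = trans (cong (_+_ (+ ms G v)) (trans (degIn-cong v (Bool.∧-inverseʳ ∘ A)) (degIn-∅ v)))
                      (ℤ.+-identityʳ _)

  IsPF⇒IsPFOn-complement : ∀ {A p} → IsPF G p → (∀ w → A w ≡ false → degIn G A w < p w) →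
                           IsPFOn G (λ w → not (A w)) (λ w → p w - degIn G A w)
  IsPF⇒IsPFOn-complement {A} {p} (_ , parks) A-closed = positive , parks′
    where
    positive : ∀ w → not (A w) ≡ true → 1ℤ ≤ p w - degIn G A w
    positive w ¬Aw = Equivalence.to i<j⇔1≤j-i (A-closed w (not-true ¬Aw))
    parks′ : ∀ T → T ⊆ (λ w → not (A w)) → NonEmpty T →
             ∃ λ w → T w ≡ true × p w - degIn G A w ≤ + ms G w + degIn G (λ z → not (A z) ∧ not (T z)) w
    parks′ T T⊆¬A nonempty with parks T (λ _ _ → refl) nonempty
    ... | w , Tw , parked =
      w , Tw , ≤-bySlack (slack (p w) (+ ms G w) (degIn G A w) (degIn G ¬A∖T w))
                         (subst (λ d → p w ≤ + ms G w + d) split parked)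
      where
      ¬A∖T : Fin n → Bool
      ¬A∖T z = not (A z) ∧ not (T z)
      slack : ∀ p s a b → (s + (a + b)) - p ≡ (s + b) - (p - a)
      slack = solve-∀
      outside : ∀ z → (not (T z) ∧ A z) ≡ A z
      outside z with A z in Az | T z in Tz
      ... | true  | true  with () ← trans (sym Az) (not-true (T⊆¬A z Tz))
      ... | true  | false = refl
      ... | false | t     = Bool.∧-zeroʳ (not t)
      split : degIn G (λ z → not (T z)) w ≡ degIn G A w + degIn G ¬A∖T w
      split = trans (degIn-split (λ z → not (T z)) A w)
                    (cong₂ _+_ (degIn-cong w outside)
                               (degIn-cong w (λ z → Bool.∧-comm (not (T z)) (not (A z)))))

  -- Strong recurrence and primality

  -- With p = deg − c, raiseExcept v p is deg − c^{v−}.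
  raiseExcept : Fin n → (Fin n → ℤ) → Fin n → ℤ
  raiseExcept v p w = p w + (if does (w ≟ v) then 0ℤ else + ms G w)

  raiseExcept-≡ : ∀ {v} p → raiseExcept v p v ≡ p v
  raiseExcept-≡ {v} p with v ≟ v
  ... | yes _  = ℤ.+-identityʳ (p v)
  ... | no v≢v = ⊥-elim (v≢v refl)

  raiseExcept-≢ : ∀ {v w} p → w ≢ v → raiseExcept v p w ≡ p w + + ms G w
  raiseExcept-≢ {v} {w} p w≢v with w ≟ v
  ... | yes w≡v = ⊥-elim (w≢v w≡v)
  ... | no _    = refl

  raiseExcept-cong : ∀ {v p q} → p ≗ q → raiseExcept v p ≗ raiseExcept v q
  raiseExcept-cong p≗q w = cong (_+ _) (p≗q w)

  ≤-raiseExcept : ∀ {v} p w → p w ≤ raiseExcept v p w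
  ≤-raiseExcept {v} p w with w ≟ v
  ... | yes _ = ℤ.i≤i+j (p w) 0ℤ
  ... | no _  = ℤ.i≤i+j (p w) (+ ms G w)

  degMinus-involutive : ∀ p → degMinus G (degMinus G p) ≗ p
  degMinus-involutive p w = involution (degG G w) (p w)
    where
    involution : ∀ d p → d - (d - p) ≡ p
    involution = solve-∀

  degMinus-injective : ∀ {c c′} → degMinus G c ≗ degMinus G c′ → c ≗ c′
  degMinus-injective {c} {c′} eq w = begin
    c w                          ≡⟨ degMinus-involutive c w ⟨
    degG G w - degMinus G c w    ≡⟨ cong (degG G w -_) (eq w) ⟩
    degG G w - degMinus G c′ w   ≡⟨ degMinus-involutive c′ w ⟩
    c′ w                         ∎
    where open ≡-Reasoning

  degMinus-minusAt : ∀ c v → degMinus G (minusAt G c v) ≗ raiseExcept v (degMinus G c)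
  degMinus-minusAt c v w with w ≟ v
  ... | yes _ = sym (ℤ.+-identityʳ _)
  ... | no _  = shift (degG G w) (c w) (+ ms G w)
    where
    shift : ∀ d c s → d - (c - s) ≡ (d - c) + s
    shift = solve-∀

  InVM⇔parkedAtSink : ∀ {c v} → InVM G c v ⇔ (1 ≤ℕ ms G v × degMinus G c v ≤ + ms G v)
  InVM⇔parkedAtSink {c} {v} = mk⇔
    (λ (1≤ms , d-ms≤c) → 1≤ms , ≤-bySlack (sym slack′) d-ms≤c)
    (λ (1≤ms , p≤ms) → 1≤ms , ≤-bySlack slack′ p≤ms)
    where
    slack : ∀ d c s → s - (d - c) ≡ c - (d - s)
    slack = solve-∀
    slack′ = slack (degG G v) (c v) (+ ms G v)

  raiseExcept-parking⇒¬positive : ∀ {p v A} → IsPF G (raiseExcept v p) → A v ≡ true →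
    NonEmpty (λ w → not (A w)) → ¬ (∀ w → not (A w) ≡ true → 1ℤ ≤ p w - degIn G A w)
  raiseExcept-parking⇒¬positive {p} {v} {A} (_ , parks) Av nonempty positive
    with parks (λ w → not (A w)) (λ _ _ → refl) nonempty
  ... | w , ¬Aw , parked =
    1≰0 (ℤ.≤-trans (positive w ¬Aw) (≤-bySlack (slack (p w) (+ ms G w) (degIn G A w)) raised))
    where
    slack : ∀ p s a → (s + a) - (p + s) ≡ 0ℤ - (p - a)
    slack = solve-∀
    w≢v : w ≢ v
    w≢v refl with () ← trans (cong not (sym Av)) ¬Aw
    raised : p w + + ms G w ≤ + ms G w + degIn G A w
    raised = subst₂ (λ x y → x ≤ + ms G w + y) (raiseExcept-≢ p w≢v)
               (degIn-cong w (Bool.not-involutive ∘ A)) parked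

  -- Grow A from {v}, adding any w with p(w) ≤ deg^A(w). No vertex of S is ever added,
  -- as p exceeds deg^{Ṽ∖S} on S; each A is G^A-parking, and once no vertex can be
  -- added p^{Ṽ∖A} is positive, so p decomposes along (A, Ṽ∖A).
  module _ {p : Fin n → ℤ} (pf : IsPF G p) {v : Fin n} (pv≤ms : p v ≤ + ms G v)
           {S : Fin n → Bool} (Sv : S v ≡ false)
           (S-unparked : ∀ w → S w ≡ true → degIn G (λ y → not (S y)) w < p w) where

    private
      Avoiding : (Fin n → Bool) → Set
      Avoiding A = A v ≡ true × (∀ w → S w ≡ true → A w ≡ false) × IsPFOn G A p

      Closed : (Fin n → Bool) → Set
      Closed A = ∀ w → A w ≡ false → degIn G A w < p w

      start : Avoiding (insert v (λ _ → false))
      start = v∈ , disjoint ,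
              IsPFOn-insert IsPFOn-∅ (proj₁ pf v refl) (ℤ.≤-trans pv≤ms (ℤ.i≤i+j _ _))
        where
        v∈ : insert v (λ _ → false) v ≡ true
        v∈ with v ≟ v
        ... | yes _  = refl
        ... | no v≢v = ⊥-elim (v≢v refl)
        disjoint : ∀ w → S w ≡ true → insert v (λ _ → false) w ≡ false
        disjoint w Sw with w ≟ v
        ... | yes refl with () ← trans (sym Sv) Sw
        ... | no _ = refl

      grow : ∀ {A} → Avoiding A → Closed A ⊎ ∃ λ w → A w ≡ false × Avoiding (insert w A)
      grow {A} (Av , disjoint , pfA) with any? (λ w → (A w Bool.≟ false) ×-dec (p w ≤? degIn G A w))
      ... | no ¬grow = inj₁ λ w Aw → ℤ.≰⇒> λ pw≤ → ¬grow (w , Aw , pw≤)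
      ... | yes (w , Aw , pw≤) = inj₂ (w , Aw , v∈ , disjoint′ ,
              IsPFOn-insert pfA (proj₁ pf w refl) (ℤ.≤-trans pw≤ (ℤ.i≤j+i _ (+ ms G w))))
        where
        v∈ : insert w A v ≡ true
        v∈ = trans (cong (_ ∨_) Av) (Bool.∨-zeroʳ _)
        A⊆¬S : A ⊆ (λ y → not (S y))
        A⊆¬S y Ay with S y in Sy
        ... | true  with () ← trans (sym Ay) (disjoint y Sy)
        ... | false = refl
        disjoint′ : ∀ y → S y ≡ true → insert w A y ≡ false
        disjoint′ y Sy with y ≟ w
        ... | yes refl = ⊥-elim (ℤ.<-irrefl refl
                           (ℤ.<-≤-trans (S-unparked y Sy) (ℤ.≤-trans pw≤ (degIn-mono y A⊆¬S))))
        ... | no _ = disjoint y Sy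

    splitting : ∃ λ A → A v ≡ true × (∀ w → S w ≡ true → A w ≡ false) × DecomposableWrt G p A
    splitting with saturate Avoiding Closed grow start
    ... | A , (Av , disjoint , pfA) , closed =
      A , Av , disjoint , pfA , IsPF⇒IsPFOn-complement pf closed

  prime⇒raiseExcept-parking : ∀ {p v} → IsPrimePF G p → p v ≤ + ms G v → IsPF G (raiseExcept v p)
  prime⇒raiseExcept-parking {p} {v} (pf@(positive , parks) , prime) pv≤ms = positive′ , parks′
    where
    positive′ : ∀ w → allV G w ≡ true → 1ℤ ≤ raiseExcept v p w
    positive′ w _ = ℤ.≤-trans (positive w refl) (≤-raiseExcept p w)
    parks′ : ∀ S → S ⊆ allV G → NonEmpty S →
             ∃ λ w → S w ≡ true × raiseExcept v p w ≤ + ms G w + degIn G (λ y → not (S y)) w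
    parks′ S _ (s , Ss) with S v in Sv
    ... | true = v , Sv , subst (_≤ _) (sym (raiseExcept-≡ p)) (ℤ.≤-trans pv≤ms (ℤ.i≤i+j _ _))
    ... | false with any? (λ w → (S w Bool.≟ true) ×-dec (p w ≤? degIn G (λ y → not (S y)) w))
    ...   | yes (w , Sw , pw≤) = w , Sw , subst (_≤ _) (sym (raiseExcept-≢ p w≢v))
                                  (subst (_≤ _) (ℤ.+-comm (+ ms G w) (p w)) (ℤ.+-monoʳ-≤ (+ ms G w) pw≤))
      where
      w≢v : w ≢ v
      w≢v refl with () ← trans (sym Sw) Sv
    ...   | no ¬parked with splitting pf pv≤ms Sv (λ w Sw → ℤ.≰⇒> λ pw≤ → ¬parked (w , Sw , pw≤))
    ...     | A , Av , disjoint , decomposable =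
      ⊥-elim (prime A (v , Av) (s , disjoint s Ss) decomposable)

  stronglyRecurrent⇒prime : ∀ {c} → IsStronglyRecurrent G c → IsPrimePF G (degMinus G c)
  stronglyRecurrent⇒prime {c} (recurrent , minus-recurrent) = recurrent⇒parking recurrent , prime
    where
    prime : ∀ A → NonEmpty A → (∃ λ b → A b ≡ false) → ¬ DecomposableWrt G (degMinus G c) A
    prime A nonempty (b , Ab) (pfA , positive , _) with IsPFOn-root pfA nonempty
    ... | v , Av , pv≤ms =
      raiseExcept-parking⇒¬positive {p = degMinus G c} {A = A} raised-parking Av (b , cong not Ab) positive
      where
      v∈VM : InVM G c v
      v∈VM = Equivalence.from (InVM⇔parkedAtSink {c})
               (ℤ.drop‿+≤+ (ℤ.≤-trans (proj₁ pfA v Av) pv≤ms) , pv≤ms)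
      raised-parking : IsPF G (raiseExcept v (degMinus G c))
      raised-parking = IsPFOn-resp (degMinus-minusAt c v) (recurrent⇒parking (minus-recurrent v v∈VM))

  prime⇒stronglyRecurrent : ∀ {p} → IsPrimePF G p → IsStronglyRecurrent G (degMinus G p)
  prime⇒stronglyRecurrent {p} prime@(pf , _) =
    parking⇒recurrent (IsPFOn-resp (sym ∘ p≗) pf) , minus-recurrent
    where
    c = degMinus G p
    p≗ : degMinus G c ≗ p
    p≗ = degMinus-involutive p
    minus-recurrent : ∀ v → InVM G c v → IsRecurrent G (minusAt G c v)
    minus-recurrent v v∈VM =
      parking⇒recurrent (IsPFOn-resp raised≗ (prime⇒raiseExcept-parking prime pv≤ms))
      where
      pv≤ms : p v ≤ + ms G v
      pv≤ms = subst (_≤ _) (p≗ v) (proj₂ (Equivalence.to (InVM⇔parkedAtSink {c}) v∈VM))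
      raised≗ : raiseExcept v p ≗ degMinus G (minusAt G c v)
      raised≗ w = sym (trans (degMinus-minusAt c v w) (raiseExcept-cong p≗ w))

theorem2p11 : ∀ {n : ℕ} (G : Graph n) →
    (∀ (c : Fin n → ℤ) → IsStronglyRecurrent G c → IsPrimePF G (degMinus G c)) ×
    (∀ (c c′ : Fin n → ℤ) → IsStronglyRecurrent G c → IsStronglyRecurrent G c′ →
       degMinus G c ≗ degMinus G c′ → c ≗ c′) ×
    (∀ (p : Fin n → ℤ) → IsPrimePF G p →
       ∃ λ (c : Fin n → ℤ) → IsStronglyRecurrent G c × degMinus G c ≗ p)
theorem2p11 G =
  (λ _ → stronglyRecurrent⇒prime G) ,
  (λ _ _ _ _ → degMinus-injective G) ,
  λ p prime → degMinus G p , prime⇒stronglyRecurrent G prime , degMinus-involutive G p
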